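{- Let $\overrightarrow{G}=\overrightarrow{G}(V,E)$ be a bipartite digraph with color classes $U,W$, and let $U=X_1\cup\cdots\cup X_r$ and $W=X_{r+1}\cup\cdots\cup X_k$ be partitions. Suppose that for each $1\le i\le k$ the group $\mathrm{Aut}_I(\overrightarrow{G})$ has a subgroup $H_i$ isomorphic to the symmetric group on $X_i$ such that (i) $H_i$ leaves $X_i$ invariant, (ii) $H_i$ acts on $X_i$ as the full symmetric group on $X_i$, and (iii) $H_i$ fixes every vertex outside $X_i$. Then each of $X_1,\ldots,X_k$ consists of pairwise equivalent vertices, and $\Gamma=\langle H_1,\ldots,H_k\rangle=H_1\times\cdots\times H_k$.
   Context: A digraph has finite vertex set $V$ and edge set $E\subseteq V\times V$ without loops ($uv$ denotes the edge with tail $u$ and head $v$; symmetric edges allowed). It is bipartite with color classes $U,W$ if $V=U\cup W$ is a partition and every edge joins a vertex of $U$ and a vertex of $W$. $N^+(v)=\{w:vw\in E\}$, $N^-(v)=\{w:wv\in E\}$. Two vertices $x,y$ are equivalent if $N^+(x)=N^+(y)$ and $N^-(x)=N^-(y)$. An automorphism is a permutation $\pi$ of $V$ with $xy\in E\Rightarrow\pi(x)\pi(y)\in E$; $\mathrm{Aut}_I(\overrightarrow{G})$ is the group of automorphisms mapping $U$ to $U$ and $W$ to $W$. -}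

module Defs where

open import Data.Nat using (ℕ; zero; suc; _<_; _≤_)
open import Data.Bool using (Bool; true; false)
open import Data.Fin using (Fin; toℕ)
import Data.Fin as F
open import Data.Fin.Permutation using (Permutation′; _⟨$⟩ʳ_; _≈_; id; flip; _∘ₚ_)
open import Data.Product using (Σ; ∃; _×_; _,_; proj₁)
open import Function.Bundles using (_↔_; Inverse; _⇔_)
open import Relation.Binary.PropositionalEquality using (_≡_; _≢_)

record Digraph (n : ℕ) : Set where
  field
    E      : Fin n → Fin n → Bool
    noLoop : ∀ v → E v v ≡ false

open Digraph public

Edge : ∀ {n} → Digraph n → Fin n → Fin n → Set
Edge G u v = E G u v ≡ true

-- Bipartite with colour classes U = {v | col v ≡ true}, W = {v | col v ≡ false}:
-- every edge joins a vertex of U and a vertex of W.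
IsBipartite : ∀ {n} → Digraph n → (Fin n → Bool) → Set
IsBipartite G col = ∀ u v → Edge G u v → col u ≢ col v

Equivalent : ∀ {n} → Digraph n → Fin n → Fin n → Set
Equivalent G x y = (∀ w → (Edge G x w ⇔ Edge G y w)) × (∀ w → (Edge G w x ⇔ Edge G w y))

IsAut : ∀ {n} → Digraph n → Permutation′ n → Set
IsAut G π = ∀ x y → Edge G x y → Edge G (π ⟨$⟩ʳ x) (π ⟨$⟩ʳ y)

IsAutI : ∀ {n} → Digraph n → (Fin n → Bool) → Permutation′ n → Set
IsAutI G col π = IsAut G π × (∀ v → col (π ⟨$⟩ʳ v) ≡ col v)

record IsSubgroupOfAutI {n} (G : Digraph n) (col : Fin n → Bool)
                        (H : Permutation′ n → Set) : Set where
  field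
    ⊆AutI   : ∀ σ → H σ → IsAutI G col σ
    resp-≈  : ∀ σ τ → σ ≈ τ → H σ → H τ
    has-id  : H id
    ∘-closed : ∀ σ τ → H σ → H τ → H (σ ∘ₚ τ)
    inv-closed : ∀ σ → H σ → H (flip σ)

Block : ∀ {n k} → (Fin n → Fin k) → Fin k → Set
Block {n} part i = Σ (Fin n) (λ v → part v ≡ i)

Sym : Set → Set
Sym X = X ↔ X

_≈ₛ_ : ∀ {X} → Sym X → Sym X → Set
ρ ≈ₛ ρ' = ∀ x → Inverse.to ρ x ≡ Inverse.to ρ' x

IsoToSym : ∀ {n} → (Permutation′ n → Set) → Set → Set
IsoToSym {n} H X =
  Σ ((σ : Permutation′ n) → H σ → Sym X) λ φ →
      (∀ σ τ (hσ : H σ) (hτ : H τ) → σ ≈ τ → φ σ hσ ≈ₛ φ τ hτ)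
    × -- homomorphism (σ ∘ₚ τ means: first σ, then τ)
      (∀ σ τ (hσ : H σ) (hτ : H τ) (hστ : H (σ ∘ₚ τ)) →
         ∀ x → Inverse.to (φ (σ ∘ₚ τ) hστ) x ≡ Inverse.to (φ τ hτ) (Inverse.to (φ σ hσ) x))
    ×
      (∀ σ τ (hσ : H σ) (hτ : H τ) → φ σ hσ ≈ₛ φ τ hτ → σ ≈ τ)
    ×
      (∀ (ρ : Sym X) → Σ (Permutation′ n) λ σ → Σ (H σ) λ hσ → φ σ hσ ≈ₛ ρ)

data Generated {n k : ℕ} (H : Fin k → Permutation′ n → Set) : Permutation′ n → Set where
  gen  : ∀ i σ → H i σ → Generated H σ
  gid  : Generated H id
  gcomp : ∀ σ τ → Generated H σ → Generated H τ → Generated H (σ ∘ₚ τ)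
  ginv : ∀ σ → Generated H σ → Generated H (flip σ)

prod : ∀ {n k} → (Fin k → Permutation′ n) → Permutation′ n
prod {k = zero} h = id
prod {k = suc k} h = h F.zero ∘ₚ prod (λ i → h (F.suc i))

IsInternalDirectProduct : ∀ {n k} → (Fin k → Permutation′ n → Set) → Set
IsInternalDirectProduct {n} {k} H =
    (∀ i j σ τ → i ≢ j → H i σ → H j τ → (σ ∘ₚ τ) ≈ (τ ∘ₚ σ))
  × (∀ γ → Generated H γ →
       Σ (Fin k → Permutation′ n) λ h → (∀ i → H i (h i)) × (γ ≈ prod h))
  × (∀ (h h' : Fin k → Permutation′ n) → (∀ i → H i (h i)) → (∀ i → H i (h' i)) →
       prod h ≈ prod h' → ∀ i → h i ≈ h' i)

{-# OPTIONS --safe #-}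
module Submission where

-- Every element of H_i fixes the vertices outside X_i, so it preserves every
-- block, and elements of different H_i commute. Hence an element of
-- ⟨H_1, …, H_k⟩ acts on each block X_i as some element of H_i, which yields the
-- direct product decomposition. For x, y ∈ X_i, the transposition (x y) of X_i
-- is realised by some σ ∈ H_i; as G is bipartite, the neighbours of x lie in
-- the other colour class, hence outside X_i, and are fixed by σ, so the
-- automorphism σ carries the edges at x onto the edges at y.

open import Defs
open import Axiom.UniquenessOfIdentityProofs using (module Decidable⇒UIP)
open import Data.Bool using (Bool; true)
open import Data.Bool.Properties using (⇔→≡)
open import Data.Fin using (Fin; zero; suc; toℕ)
open import Data.Fin.Properties using (_≟_; suc-injective)
open import Data.Fin.Permutation
  using (Permutation′; _⟨$⟩ʳ_; _⟨$⟩ˡ_; _≈_; id; flip; _∘ₚ_; inverseˡ; inverseʳ; transpose)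
open import Data.Nat using (ℕ; _<_; _≤_)
open import Data.Product using (Σ; ∃; _×_; _,_; proj₁)
open import Data.Vec.Functional using (updateAt)
open import Data.Vec.Functional.Properties using (updateAt-updates; updateAt-minimal)
open import Function using (const; _∘_)
open import Function.Bundles using (_⇔_; Inverse; mk↔ₛ′; mk⇔)
import Function.Properties.Equivalence as ⇔
open import Relation.Binary.PropositionalEquality
open import Relation.Nullary using (yes; no; contradiction)

module _ {n : ℕ} where

  prod-fixes : ∀ {m} (h : Fin m → Permutation′ n) {v} →
    (∀ i → h i ⟨$⟩ʳ v ≡ v) → prod h ⟨$⟩ʳ v ≡ v
  prod-fixes {ℕ.zero}  h fixed = refl
  prod-fixes {ℕ.suc m} h fixed =
    trans (cong (prod (h ∘ suc) ⟨$⟩ʳ_) (fixed zero)) (prod-fixes (h ∘ suc) (fixed ∘ suc))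

  prod-acts-as : ∀ {m} (h : Fin m → Permutation′ n) {v} j →
    (∀ i → i ≢ j → h i ⟨$⟩ʳ v ≡ v) →
    (∀ i → i ≢ j → h i ⟨$⟩ʳ (h j ⟨$⟩ʳ v) ≡ h j ⟨$⟩ʳ v) →
    prod h ⟨$⟩ʳ v ≡ h j ⟨$⟩ʳ v
  prod-acts-as h zero fixesV fixesImage =
    prod-fixes (h ∘ suc) (λ i → fixesImage (suc i) λ ())
  prod-acts-as h (suc j) fixesV fixesImage =
    trans (cong (prod (h ∘ suc) ⟨$⟩ʳ_) (fixesV zero λ ()))
          (prod-acts-as (h ∘ suc) j (λ i → fixesV (suc i) ∘ (_∘ suc-injective))
                                    (λ i → fixesImage (suc i) ∘ (_∘ suc-injective)))

module _ {n k : ℕ} (part : Fin n → Fin k) where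

  record SupportedOnBlock (i : Fin k) (σ : Permutation′ n) : Set where
    constructor supportedOnBlock
    field
      keeps-block   : ∀ v → part v ≡ i → part (σ ⟨$⟩ʳ v) ≡ i
      fixes-outside : ∀ v → part v ≢ i → σ ⟨$⟩ʳ v ≡ v

  open SupportedOnBlock

  supported⇒part-invariant : ∀ {i σ} → SupportedOnBlock i σ →
    ∀ v → part (σ ⟨$⟩ʳ v) ≡ part v
  supported⇒part-invariant {i} (supportedOnBlock keeps fixes) v with part v ≟ i
  ... | yes v∈i = trans (keeps v v∈i) (sym v∈i)
  ... | no  v∉i = cong part (fixes v v∉i)

  supported-fixes-orbit : ∀ {i j σ τ} → SupportedOnBlock i σ → SupportedOnBlock j τ →
    ∀ v → part v ≢ i → σ ⟨$⟩ʳ (τ ⟨$⟩ʳ v) ≡ τ ⟨$⟩ʳ v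
  supported-fixes-orbit σ-supp τ-supp v v∉i =
    fixes-outside σ-supp _ (v∉i ∘ trans (sym (supported⇒part-invariant τ-supp v)))

  supported-commute : ∀ {i j σ τ} → i ≢ j →
    SupportedOnBlock i σ → SupportedOnBlock j τ → (σ ∘ₚ τ) ≈ (τ ∘ₚ σ)
  supported-commute {i} {j} {σ} {τ} i≢j σ-supp τ-supp v with part v ≟ i
  ... | yes v∈i = trans (supported-fixes-orbit τ-supp σ-supp v v∉j)
                        (cong (σ ⟨$⟩ʳ_) (sym (fixes-outside τ-supp v v∉j)))
    where
    v∉j : part v ≢ j
    v∉j = i≢j ∘ trans (sym v∈i)
  ... | no v∉i = trans (cong (τ ⟨$⟩ʳ_) (fixes-outside σ-supp v v∉i))
                       (sym (supported-fixes-orbit σ-supp τ-supp v v∉i))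

  prod-supported : (h : Fin k → Permutation′ n) → (∀ i → SupportedOnBlock i (h i)) →
    ∀ v → prod h ⟨$⟩ʳ v ≡ h (part v) ⟨$⟩ʳ v
  prod-supported h supp v = prod-acts-as h (part v)
    (λ i i≢pv → fixes-outside (supp i) v (i≢pv ∘ sym))
    (λ i i≢pv → supported-fixes-orbit (supp i) (supp (part v)) v (i≢pv ∘ sym))

  block-≡ : ∀ {i} {x y : Block part i} → proj₁ x ≡ proj₁ y → x ≡ y
  block-≡ {x = v , p} {y = .v , q} refl = cong (v ,_) (Decidable⇒UIP.≡-irrelevant _≟_ p q)

  restrictToBlock : (π : Permutation′ n) → (∀ v → part (π ⟨$⟩ʳ v) ≡ part v) →
    ∀ i → Sym (Block part i)
  restrictToBlock π invariant i = mk↔ₛ′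
    (λ (v , v∈i) → π ⟨$⟩ʳ v , trans (invariant v) v∈i)
    (λ (v , v∈i) → π ⟨$⟩ˡ v , trans invariant⁻¹ v∈i)
    (λ _ → block-≡ (inverseʳ π))
    (λ _ → block-≡ (inverseˡ π))
    where
    invariant⁻¹ : ∀ {v} → part (π ⟨$⟩ˡ v) ≡ part v
    invariant⁻¹ {v} = trans (sym (invariant (π ⟨$⟩ˡ v))) (cong part (inverseʳ π))

  transpose-part-invariant : ∀ {x y} → part x ≡ part y →
    ∀ v → part (transpose x y ⟨$⟩ʳ v) ≡ part v
  transpose-part-invariant {x} {y} x~y v with v ≟ x
  ... | yes refl = sym x~y
  ... | no _ with v ≟ y
  ...   | yes refl = x~y
  ...   | no _     = refl

  transpose-sends : ∀ (x y : Fin n) → transpose x y ⟨$⟩ʳ x ≡ y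
  transpose-sends x y with x ≟ x
  ... | yes _   = refl
  ... | no x≢x = contradiction refl x≢x

  transposition-realised : (H : Fin k → Permutation′ n → Set) →
    (∀ i (ρ : Sym (Block part i)) → Σ (Permutation′ n) λ σ → H i σ ×
       (∀ (x : Block part i) → σ ⟨$⟩ʳ proj₁ x ≡ proj₁ (Inverse.to ρ x))) →
    ∀ {x y} → part x ≡ part y → ∃ λ σ → H (part x) σ × σ ⟨$⟩ʳ x ≡ y
  transposition-realised H realise {x} {y} x~y
    with realise (part x) (restrictToBlock (transpose x y) (transpose-part-invariant x~y) (part x))
  ... | σ , σ∈H , acts = σ , σ∈H , trans (acts (x , refl)) (transpose-sends x y)

  module DirectProduct
    (H : Fin k → Permutation′ n → Set)
    (supported : ∀ i σ → H i σ → SupportedOnBlock i σ)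
    (has-id : ∀ i → H i id)
    (∘-closed : ∀ i σ τ → H i σ → H i τ → H i (σ ∘ₚ τ))
    (inv-closed : ∀ i σ → H i σ → H i (flip σ))
    where

    family-supported : ∀ (h : Fin k → Permutation′ n) → (∀ i → H i (h i)) →
      ∀ i → SupportedOnBlock i (h i)
    family-supported h h∈H i = supported i (h i) (h∈H i)

    Blockwise : Permutation′ n → Set
    Blockwise γ = Σ (Fin k → Permutation′ n) λ h →
      (∀ i → H i (h i)) × (∀ v → γ ⟨$⟩ʳ v ≡ h (part v) ⟨$⟩ʳ v)

    generator-blockwise : ∀ i σ → H i σ → Blockwise σ
    generator-blockwise i σ σ∈H = h , h∈H , acts
      where
      h : Fin k → Permutation′ n
      h = updateAt (const id) i (const σ)
      h∈H : ∀ j → H j (h j)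
      h∈H j with j ≟ i
      ... | yes refl = subst (H j) (sym (updateAt-updates j (const id))) σ∈H
      ... | no j≢i  = subst (H j) (sym (updateAt-minimal j i (const id) j≢i)) (has-id j)
      acts : ∀ v → σ ⟨$⟩ʳ v ≡ h (part v) ⟨$⟩ʳ v
      acts v with part v ≟ i
      ... | yes refl = cong (_⟨$⟩ʳ v) (sym (updateAt-updates (part v) (const id)))
      ... | no v∉i  = trans (fixes-outside (supported i σ σ∈H) v v∉i)
                            (cong (_⟨$⟩ʳ v) (sym (updateAt-minimal _ i (const id) v∉i)))

    id-blockwise : Blockwise id
    id-blockwise = const id , has-id , λ _ → refl

    ∘-blockwise : ∀ {σ τ} → Blockwise σ → Blockwise τ → Blockwise (σ ∘ₚ τ)
    ∘-blockwise {σ} {τ} (f , f∈H , σ-acts) (g , g∈H , τ-acts) =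
      (λ i → f i ∘ₚ g i) , (λ i → ∘-closed i (f i) (g i) (f∈H i) (g∈H i)) , acts
      where
      acts : ∀ v → τ ⟨$⟩ʳ (σ ⟨$⟩ʳ v) ≡ g (part v) ⟨$⟩ʳ (f (part v) ⟨$⟩ʳ v)
      acts v = begin
        τ ⟨$⟩ʳ (σ ⟨$⟩ʳ v)  ≡⟨ cong (τ ⟨$⟩ʳ_) (σ-acts v) ⟩
        τ ⟨$⟩ʳ u           ≡⟨ τ-acts u ⟩
        g (part u) ⟨$⟩ʳ u  ≡⟨ cong (λ j → g j ⟨$⟩ʳ u) u-in-block ⟩
        g (part v) ⟨$⟩ʳ u  ∎
        where
        open ≡-Reasoning
        u = f (part v) ⟨$⟩ʳ v
        u-in-block : part u ≡ part v
        u-in-block = supported⇒part-invariant (family-supported f f∈H (part v)) v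

    flip-blockwise : ∀ {σ} → Blockwise σ → Blockwise (flip σ)
    flip-blockwise {σ} (f , f∈H , σ-acts) =
      (λ i → flip (f i)) , flip∈H , acts
      where
      flip∈H : ∀ i → H i (flip (f i))
      flip∈H i = inv-closed i (f i) (f∈H i)
      acts : ∀ v → σ ⟨$⟩ˡ v ≡ f (part v) ⟨$⟩ˡ v
      acts v = begin
        σ ⟨$⟩ˡ v           ≡⟨ cong (σ ⟨$⟩ˡ_) σu≡v ⟨
        σ ⟨$⟩ˡ (σ ⟨$⟩ʳ u)  ≡⟨ inverseˡ σ ⟩
        u                 ∎
        where
        open ≡-Reasoning
        u = f (part v) ⟨$⟩ˡ v
        u-in-block : part u ≡ part v
        u-in-block = supported⇒part-invariant (family-supported (flip ∘ f) flip∈H (part v)) v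
        σu≡v : σ ⟨$⟩ʳ u ≡ v
        σu≡v = trans (σ-acts u)
                     (trans (cong (λ j → f j ⟨$⟩ʳ u) u-in-block) (inverseʳ (f (part v))))

    generated-blockwise : ∀ {γ} → Generated H γ → Blockwise γ
    generated-blockwise (gen i σ σ∈H)   = generator-blockwise i σ σ∈H
    generated-blockwise gid             = id-blockwise
    generated-blockwise (gcomp σ τ p q) =
      ∘-blockwise {σ} {τ} (generated-blockwise p) (generated-blockwise q)
    generated-blockwise (ginv σ p)      = flip-blockwise {σ} (generated-blockwise p)

    generated-decomposes : ∀ γ → Generated H γ →
      Σ (Fin k → Permutation′ n) λ h → (∀ i → H i (h i)) × (γ ≈ prod h)
    generated-decomposes γ γ∈Γ with generated-blockwise γ∈Γ
    ... | h , h∈H , acts =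
      h , h∈H , λ v → trans (acts v) (sym (prod-supported h (family-supported h h∈H) v))

    decomposition-unique : ∀ (h h' : Fin k → Permutation′ n) →
      (∀ i → H i (h i)) → (∀ i → H i (h' i)) → prod h ≈ prod h' → ∀ i → h i ≈ h' i
    decomposition-unique h h' h∈H h'∈H prod≈ i v with part v ≟ i
    ... | yes refl = begin
      h (part v) ⟨$⟩ʳ v   ≡⟨ prod-supported h (family-supported h h∈H) v ⟨
      prod h ⟨$⟩ʳ v       ≡⟨ prod≈ v ⟩
      prod h' ⟨$⟩ʳ v      ≡⟨ prod-supported h' (family-supported h' h'∈H) v ⟩
      h' (part v) ⟨$⟩ʳ v  ∎
      where open ≡-Reasoning
    ... | no v∉i = trans (fixes-outside (family-supported h h∈H i) v v∉i)
                         (sym (fixes-outside (family-supported h' h'∈H i) v v∉i))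

    internalDirectProduct : IsInternalDirectProduct H
    internalDirectProduct =
        (λ i j σ τ i≢j σ∈H τ∈H → supported-commute i≢j (supported i σ σ∈H) (supported j τ τ∈H))
      , generated-decomposes
      , decomposition-unique

sameBlock⇒sameColour : ∀ {n k r} {col : Fin n → Bool} {part : Fin n → Fin k} →
  (∀ v → (col v ≡ true) ⇔ (toℕ (part v) < r)) → ∀ {x y} → part x ≡ part y → col x ≡ col y
sameBlock⇒sameColour {r = r} {col} colour {x} {y} x~y =
  ⇔→≡ (⇔.trans (colour x) 
         (⇔.sym (subst (λ j → col y ≡ true ⇔ toℕ j < r) (sym x~y) (colour y))))

module _ {n k : ℕ} (G : Digraph n) {col : Fin n → Bool} (bipartite : IsBipartite G col)
  {part : Fin n → Fin k} (sameColour : ∀ {x y} → part x ≡ part y → col x ≡ col y) where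

  adjacent⇒differentBlocks : ∀ {x w} → Edge G x w → part x ≢ part w
  adjacent⇒differentBlocks {x} {w} e = bipartite x w e ∘ sameColour

  module _ {x y : Fin n} (σ : Permutation′ n) (aut : IsAut G σ)
    (fixes : ∀ v → part v ≢ part x → σ ⟨$⟩ʳ v ≡ v) (σx≡y : σ ⟨$⟩ʳ x ≡ y) where

    out-edges-transfer : ∀ w → Edge G x w → Edge G y w
    out-edges-transfer w e =
      subst₂ (Edge G) σx≡y (fixes w (adjacent⇒differentBlocks e ∘ sym)) (aut x w e)

    in-edges-transfer : ∀ w → Edge G w x → Edge G w y
    in-edges-transfer w e =
      subst₂ (Edge G) (fixes w (adjacent⇒differentBlocks e)) σx≡y (aut w x e)

  blockTransitive⇒equivalent :
    (∀ x y → part x ≡ part y → ∃ λ σ →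
       IsAut G σ × (∀ v → part v ≢ part x → σ ⟨$⟩ʳ v ≡ v) × σ ⟨$⟩ʳ x ≡ y) →
    ∀ x y → part x ≡ part y → Equivalent G x y
  blockTransitive⇒equivalent move x y x~y with move x y x~y | move y x (sym x~y)
  ... | σ , σ-aut , σ-fixes , σx≡y | τ , τ-aut , τ-fixes , τy≡x =
      (λ w → mk⇔ (out-edges-transfer σ σ-aut σ-fixes σx≡y w)
                 (out-edges-transfer τ τ-aut τ-fixes τy≡x w))
    , (λ w → mk⇔ (in-edges-transfer σ σ-aut σ-fixes σx≡y w)
                 (in-edges-transfer τ τ-aut τ-fixes τy≡x w))

proposition4p4 : ∀ {n : ℕ} (G : Digraph n) (col : Fin n → Bool) → IsBipartite G col →
    ∀ (r k : ℕ) → r ≤ k → (part : Fin n → Fin k) →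
    (∀ i → ∃ λ v → part v ≡ i) →
    (∀ v → (col v ≡ true) ⇔ (toℕ (part v) < r)) →
    (H : Fin k → Permutation′ n → Set) →
    (∀ i → IsSubgroupOfAutI G col (H i)) →
    (∀ i → IsoToSym (H i) (Block part i)) →
    (∀ i σ → H i σ → ∀ v → part v ≡ i → part (σ ⟨$⟩ʳ v) ≡ i) →
    (∀ i (ρ : Sym (Block part i)) → Σ (Permutation′ n) λ σ → H i σ ×
       (∀ (x : Block part i) → σ ⟨$⟩ʳ proj₁ x ≡ proj₁ (Inverse.to ρ x))) →
    (∀ i σ → H i σ → ∀ v → part v ≢ i → σ ⟨$⟩ʳ v ≡ v) →
    (∀ x y → part x ≡ part y → Equivalent G x y)
    × IsInternalDirectProduct H
proposition4p4 G _ bipartite _ _ _ part _ colour H subgroup _ keeps realise fixes =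
    blockTransitive⇒equivalent G bipartite (sameBlock⇒sameColour colour) move
  , DirectProduct.internalDirectProduct part H supported
      (has-id ∘ subgroup) (∘-closed ∘ subgroup) (inv-closed ∘ subgroup)
  where
  open IsSubgroupOfAutI

  supported : ∀ i σ → H i σ → SupportedOnBlock part i σ
  supported i σ σ∈H = supportedOnBlock (keeps i σ σ∈H) (fixes i σ σ∈H)

  move : ∀ x y → part x ≡ part y → ∃ λ σ →
    IsAut G σ × (∀ v → part v ≢ part x → σ ⟨$⟩ʳ v ≡ v) × σ ⟨$⟩ʳ x ≡ y
  move x y x~y with transposition-realised part H realise x~y
  ... | σ , σ∈H , σx≡y =
    σ , proj₁ (⊆AutI (subgroup (part x)) σ σ∈H) , fixes (part x) σ σ∈H , σx≡y
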